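{- For every even integer $n\ge 8$, the Goldbach factorization graph $F_n$ contains a vertex $v\in V_n$ without a loop, i.e. with $(v,v)\notin A_n$. (For $n=4$ and $n=6$, every vertex of $F_n$ has a loop.)
   Context: For an even integer $n\ge 4$, the Goldbach factorization graph is the directed weighted graph $F_n=(V_n,A_n,w_n)$ with vertex set $V_n=[2,n-2]\cap\mathbb{P}$ ($\mathbb{P}$ the set of primes), arc set $A_n=\{(s,t)\in V_n^2 : s \mid (n-t)\}$ (loops allowed), and weights $w_n((s,t))=\max\{e\ge 1: s^e\mid (n-t)\}$. -}

module Defs where

open import Data.Nat using (ℕ; _∸_; _≤_)
open import Data.Nat.Divisibility using (_∣_)
open import Data.Nat.Primality using (Prime)
open import Data.Product using (_×_)

IsVertex : ℕ → ℕ → Set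
IsVertex n v = Prime v × 2 ≤ v × v ≤ n ∸ 2

-- Arc set A_n = {(s,t) ∈ V_n² : s ∣ (n - t)}  (loops allowed).
-- Since t ≤ n - 2, truncated subtraction n ∸ t equals n - t.
IsArc : ℕ → ℕ → ℕ → Set
IsArc n s t = IsVertex n s × IsVertex n t × s ∣ n ∸ t

{-# OPTIONS --safe #-}
module Submission where

-- Writing an even n ≥ 8 as 2(e + k) with k ≥ 3 odd and e ∈ {1, 2}, any prime
-- divisor p of k is a vertex, since p ≤ k ≤ n - 2. A loop at p would mean
-- p ∣ n - p, i.e. p ∣ n = 2(e + k); p is odd, so p ∣ e + k, hence p ∣ e ∣ 2,
-- which is impossible. For n = 4 and n = 6 the vertices 2, 3 all divide n.

open import Defs
open import Data.Nat using (ℕ; suc; _+_; _*_; _∸_; _≤_; z≤n; s≤s; nonTrivial⇒n>1)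
open import Data.Nat.Properties
open import Data.Nat.Divisibility
open import Data.Nat.Primality
open import Data.Nat.Primality.Factorisation using (factorise)
open import Data.Nat.ListAction using (product)
open import Data.List using ([]; _∷_)
open import Data.List.Relation.Unary.All using (_∷_)
open import Data.Product using (_×_; _,_; ∃)
open import Data.Sum using (inj₁; inj₂)
open import Relation.Nullary using (¬_; yes; no; contradiction)
open import Relation.Binary.PropositionalEquality using (_≡_; refl; sym; trans; subst)

prime⇒≥2 : ∀ {p} → Prime p → 2 ≤ p
prime⇒≥2 {p} pp = nonTrivial⇒n>1 p {{prime⇒nonTrivial pp}}

prime∣2⇒≡2 : ∀ {p} → Prime p → p ∣ 2 → p ≡ 2
prime∣2⇒≡2 pp p∣2 = ≤-antisym (∣⇒≤ p∣2) (prime⇒≥2 pp)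

∃prime∣ : ∀ {k} → 2 ≤ k → ∃ λ p → Prime p × p ∣ k
∃prime∣ {suc k} 2≤k with factorise (suc k)
... | record { factors = [] ; isFactorisation = k≡1 } with ≤-trans 2≤k (≤-reflexive k≡1)
...   | s≤s ()
∃prime∣ {suc k} _ | record { factors = p ∷ ps ; isFactorisation = eq ; factorsPrime = pp ∷ _ } =
  p , pp , divides (product ps) (trans eq (*-comm p (product ps)))

2∣n⇒2∤1+n : ∀ {n} → 2 ∣ n → 2 ∤ suc n
2∣n⇒2∤1+n {n} 2∣n 2∣1+n =
  contradiction (∣1⇒≡1 (∣m+n∣m⇒∣n (subst (2 ∣_) (+-comm 1 n) 2∣1+n) 2∣n)) λ ()

loop⇒∣ : ∀ {n v} → IsArc n v v → v ∣ n
loop⇒∣ {n} {v} (_ , (_ , _ , v≤n∸2) , v∣n∸v) =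
  ∣m∸n∣n⇒∣m v (≤-trans v≤n∸2 (m∸n≤m n 2)) v∣n∸v ∣-refl

prime∣odd⇒∤2*[e+odd] : ∀ {p e k} → Prime p → p ∣ k → 2 ∤ k → e ∣ 2 → p ∤ 2 * (e + k)
prime∣odd⇒∤2*[e+odd] {p} {e} {k} pp p∣k 2∤k e∣2 p∣2[e+k] =
  2∤k (subst (_∣ k) (prime∣2⇒≡2 pp p∣2) p∣k)
  where
  p∣2 : p ∣ 2
  p∣2 with euclidsLemma 2 (e + k) pp p∣2[e+k]
  ... | inj₁ p∣2 = p∣2
  ... | inj₂ p∣e+k = ∣-trans (∣m+n∣m⇒∣n (subst (p ∣_) (+-comm e k) p∣e+k) p∣k) e∣2

even≥8-split : ∀ {n} → 2 ∣ n → 8 ≤ n →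
  ∃ λ e → ∃ λ k → 2 ≤ k × 2 ∤ k × e ∣ 2 × n ≡ 2 * (e + k)
even≥8-split (divides m n≡m*2) 8≤n
  with *-cancelʳ-≤ 4 m 2 (subst (8 ≤_) n≡m*2 8≤n)
     | trans n≡m*2 (*-comm m 2)
... | s≤s (s≤s (s≤s (s≤s {n = j} _))) | n≡2*m with 2 ∣? (3 + j)
...   | yes 2∣3+j = 2 , 2 + j , s≤s (s≤s z≤n) , (λ 2∣2+j → 2∣n⇒2∤1+n 2∣2+j 2∣3+j) , ∣-refl , n≡2*m
...   | no 2∤3+j = 1 , 3 + j , s≤s (s≤s z≤n) , 2∤3+j , divides 2 refl , n≡2*m

≤double∸2 : ∀ e {k} → 2 ≤ k → k ≤ 2 * (e + k) ∸ 2
≤double∸2 e {k} 2≤k = m+n≤o⇒m≤o∸n k (begin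
  k + 2        ≤⟨ +-monoʳ-≤ k (subst (2 ≤_) (sym (+-identityʳ k)) 2≤k) ⟩
  2 * k        ≤⟨ *-monoʳ-≤ 2 (m≤n+m k e) ⟩
  2 * (e + k)  ∎)
  where open ≤-Reasoning

loopless-vertex : (n : ℕ) → 2 ∣ n → 8 ≤ n → ∃ λ v → IsVertex n v × ¬ IsArc n v v
loopless-vertex n 2∣n 8≤n with even≥8-split 2∣n 8≤n
... | e , k , 2≤k@(s≤s (s≤s _)) , 2∤k , e∣2 , n≡2*[e+k] with ∃prime∣ 2≤k
...   | p , pp , p∣k =
  p , vertex , λ loop → prime∣odd⇒∤2*[e+odd] pp p∣k 2∤k e∣2 (subst (p ∣_) n≡2*[e+k] (loop⇒∣ loop))
  where
  vertex : IsVertex n p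
  vertex = pp , prime⇒≥2 pp
         , subst (λ m → p ≤ m ∸ 2) (sym n≡2*[e+k]) (≤-trans (∣⇒≤ p∣k) (≤double∸2 e 2≤k))

loops₄ : (v : ℕ) → IsVertex 4 v → IsArc 4 v v
loops₄ 2 h = h , h , divides 1 refl
loops₄ (suc (suc (suc _))) (_ , _ , s≤s (s≤s ()))

loops₆ : (v : ℕ) → IsVertex 6 v → IsArc 6 v v
loops₆ 2 h = h , h , divides 2 refl
loops₆ 3 h = h , h , divides 1 refl
loops₆ 4 (4-prime , _) = contradiction composite[4] (prime⇒¬composite 4-prime)
loops₆ (suc (suc (suc (suc (suc _))))) (_ , _ , s≤s (s≤s (s≤s (s≤s ()))))

mainTheorem15 : ((n : ℕ) → 2 ∣ n → 8 ≤ n → ∃ λ v → IsVertex n v × ¬ IsArc n v v)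
    × ((v : ℕ) → IsVertex 4 v → IsArc 4 v v)
    × ((v : ℕ) → IsVertex 6 v → IsArc 6 v v)
mainTheorem15 = loopless-vertex , loops₄ , loops₆
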